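{- For a finite set $Z$, a row-stochastic kernel $P$ on $Z$, an integer $\tau\ge1$, a map $f:Z\to X$ to a finite set, and prototype distributions $(u_x)_{x\in X}$ with $\mathrm{supp}(u_x)\subseteq f^{ -1}(x)$, call $u_x$ $\varepsilon$-stable if $\|E_{\tau,f}(u_x)-u_x\|_{\mathrm{TV}}\le\varepsilon$, where $E_{\tau,f}(\mu)=U_f(Q_f(\mu P^\tau))$, $(Q_f\mu)(x)=\sum_{z\in f^{ -1}(x)}\mu(z)$ and $(U_f\nu)(z)=\sum_x\nu(x)u_x(z)$. Then both of the following occur: (1) there exist $Z,P,\tau$, two lenses $f_{\mathrm{fine}}:Z\to X_{\mathrm{fine}}$ and $f_{\mathrm{coarse}}:Z\to X_{\mathrm{coarse}}$ with $f_{\mathrm{coarse}}=g\circ f_{\mathrm{fine}}$ for some map $g$ (so the fine partition refines the coarse one), prototype families for each lens, and a threshold $\varepsilon>0$ such that the number of $\varepsilon$-stable prototypes for $f_{\mathrm{fine}}$ is strictly larger than for $f_{\mathrm{coarse}}$; (2) there exist such data for which the number of $\varepsilon$-stable prototypes for $f_{\mathrm{fine}}$ is strictly smaller than for $f_{\mathrm{coarse}}$.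
   Context: $\Delta(Z)$ is the simplex of probability distributions on $Z$ (row vectors), and $\|\mu-\nu\|_{\mathrm{TV}}=\tfrac12\|\mu-\nu\|_1$. -}

module Defs where

open import Data.Nat using (ℕ; zero; suc)
open import Data.Fin using (Fin; zero; suc; _≟_)
open import Data.Rational using (ℚ; 0ℚ; 1ℚ; ½; _+_; _*_; _-_; ∣_∣; _≤_)
open import Data.Rational.Properties using (_≤?_)
open import Relation.Nullary using (yes; no; ¬_; does)
open import Data.Bool using (Bool; if_then_else_)
import Data.Nat
open import Relation.Binary.PropositionalEquality using (_≡_)
open import Data.Product using (_×_)

∑ : ∀ {n} → (Fin n → ℚ) → ℚ
∑ {zero}  g = 0ℚ
∑ {suc n} g = g zero + ∑ (λ i → g (suc i))

Vec : ℕ → Set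
Vec n = Fin n → ℚ

Kernel : ℕ → Set
Kernel n = Fin n → Fin n → ℚ

IsDist : ∀ {n} → Vec n → Set
IsDist {n} μ = (∀ z → 0ℚ ≤ μ z) × ∑ μ ≡ 1ℚ

IsStochastic : ∀ {n} → Kernel n → Set
IsStochastic P = ∀ z → IsDist (P z)

_·_ : ∀ {n} → Vec n → Kernel n → Vec n
(μ · P) z' = ∑ (λ z → μ z * P z z')

evolve : ∀ {n} → Kernel n → ℕ → Vec n → Vec n
evolve P zero    μ = μ
evolve P (suc t) μ = evolve P t μ · P

TV : ∀ {n} → Vec n → Vec n → ℚ
TV μ ν = ½ * ∑ (λ z → ∣ μ z - ν z ∣)

[_≡_] : ∀ {m} → Fin m → Fin m → ℚ
[ a ≡ b ] with a ≟ b
... | yes _ = 1ℚ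
... | no  _ = 0ℚ

Q : ∀ {n m} → (Fin n → Fin m) → Vec n → (Fin m → ℚ)
Q f μ x = ∑ (λ z → [ f z ≡ x ] * μ z)

U : ∀ {n m} → (Fin m → Vec n) → (Fin m → ℚ) → Vec n
U u ν z = ∑ (λ x → ν x * u x z)

E : ∀ {n m} → Kernel n → ℕ → (Fin n → Fin m) → (Fin m → Vec n) → Vec n → Vec n
E P τ f u μ = U u (Q f (evolve P τ μ))

IsPrototypeFamily : ∀ {n m} → (Fin n → Fin m) → (Fin m → Vec n) → Set
IsPrototypeFamily f u = ∀ x → IsDist (u x) × (∀ z → ¬ (f z ≡ x) → u x z ≡ 0ℚ)

Stable : ∀ {n m} → Kernel n → ℕ → (Fin n → Fin m) → (Fin m → Vec n) → ℚ → Fin m → Set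
Stable P τ f u ε x = TV (E P τ f u (u x)) (u x) ≤ ε

countTrue : ∀ {m} → (Fin m → Bool) → ℕ
countTrue {zero}  b = zero
countTrue {suc m} b = (if b zero then 1 else 0) Data.Nat.+ countTrue (λ i → b (suc i))

countStable : ∀ {n m} → Kernel n → ℕ → (Fin n → Fin m) → (Fin m → Vec n) → ℚ → ℕ
countStable P τ f u ε = countTrue (λ x → does (TV (E P τ f u (u x)) (u x) ≤? ε))

{-# OPTIONS --safe #-}
module Submission where

-- On two points with point-mass prototypes, all TV distances involved are 0 or 1, so
-- ε = ½ just asks for exact stability. Under the identity kernel every prototype is a fixed
-- point of E, and the discrete lens wins simply because it has more prototypes. Under the
-- swap, each point mass of the discrete lens is sent to the other point, whereas the
-- one-block lens only records total mass, which P preserves, so its single prototype is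
-- stable.

open import Defs
open import Data.Nat using (ℕ; zero; suc; _≥_; _<_; _>_)
open import Data.Nat.Properties using (≤-refl; n<1+n)
open import Data.Fin using (Fin; zero; suc; _≟_)
open import Data.Rational using (ℚ; 0ℚ; 1ℚ; ½; _+_) renaming (_<_ to _<ℚ_; _≤_ to _≤ℚ_)
import Data.Rational.Properties as ℚ
open import Data.Product using (Σ; _×_; ∃-syntax; _,_)
open import Function using (id)
open import Relation.Binary.PropositionalEquality using (_≡_; _≢_; refl; sym; cong; cong₂; subst₂; module ≡-Reasoning)
open import Relation.Nullary using (yes; no; contradiction)

private
  variable
    n : ℕ

[≡]-≢ : {x y : Fin n} → x ≢ y → [ x ≡ y ] ≡ 0ℚ
[≡]-≢ {x = x} {y} x≢y with x ≟ y
... | yes x≡y = contradiction x≡y x≢y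
... | no  _   = refl

[≡]-nonNegative : (x y : Fin n) → 0ℚ ≤ℚ [ x ≡ y ]
[≡]-nonNegative x y with x ≟ y
... | yes _ = ℚ.<⇒≤ (ℚ.positive⁻¹ 1ℚ)
... | no  _ = ℚ.≤-refl

∑-zero : ∑ {n} (λ _ → 0ℚ) ≡ 0ℚ
∑-zero {zero}  = refl
∑-zero {suc n} = cong (0ℚ +_) (∑-zero {n})

∑-cong : {f g : Vec n} → (∀ z → f z ≡ g z) → ∑ f ≡ ∑ g
∑-cong {zero}  f≗g = refl
∑-cong {suc n} f≗g = cong₂ _+_ (f≗g zero) (∑-cong (λ z → f≗g (suc z)))

[suc≡suc] : (x y : Fin n) → [ suc x ≡ suc y ] ≡ [ x ≡ y ]
[suc≡suc] x y with x ≟ y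
... | yes _ = refl
... | no  _ = refl

δ : Fin n → Vec n
δ x z = [ x ≡ z ]

∑-δ : (x : Fin n) → ∑ (δ x) ≡ 1ℚ
∑-δ {suc n} zero    = cong (1ℚ +_) (∑-zero {n})
∑-δ {suc n} (suc x) = begin
  0ℚ + ∑ (λ z → [ suc x ≡ suc z ]) ≡⟨ ℚ.+-identityˡ _ ⟩
  ∑ (λ z → [ suc x ≡ suc z ])      ≡⟨ ∑-cong ([suc≡suc] x) ⟩
  ∑ (δ x)                          ≡⟨ ∑-δ x ⟩
  1ℚ                               ∎
  where open ≡-Reasoning

δ-isDist : (x : Fin n) → IsDist (δ x)
δ-isDist x = [≡]-nonNegative x , ∑-δ x

deterministic : (Fin n → Fin n) → Kernel n
deterministic π z = δ (π z)

deterministic-isStochastic : (π : Fin n → Fin n) → IsStochastic (deterministic π)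
deterministic-isStochastic π z = δ-isDist (π z)

δ-isPrototypeFamily : IsPrototypeFamily {n} id δ
δ-isPrototypeFamily x = δ-isDist x , λ z z≢x → [≡]-≢ (λ x≡z → z≢x (sym x≡z))

collapse : Fin n → Fin 1
collapse _ = zero

collapse-isPrototypeFamily : {μ : Vec n} → IsDist μ → IsPrototypeFamily collapse (λ _ → μ)
collapse-isPrototypeFamily μ-isDist zero = μ-isDist , λ z z≢0 → contradiction refl z≢0

swap : Fin 2 → Fin 2
swap zero       = suc zero
swap (suc zero) = zero

CoarseFineExample : (ℕ → ℕ → Set) → Set
CoarseFineExample _compare_ =
  ∃[ n ] Σ (Kernel n) λ P → Σ ℕ λ τ → ∃[ mF ] ∃[ mC ]
    Σ (Fin n → Fin mF) λ fF → Σ (Fin n → Fin mC) λ fC → Σ (Fin mF → Fin mC) λ g →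
    Σ (Fin mF → Vec n) λ uF → Σ (Fin mC → Vec n) λ uC → Σ ℚ λ ε →
      IsStochastic P × τ ≥ 1 × (∀ z → fC z ≡ g (fF z))
      × IsPrototypeFamily fF uF × IsPrototypeFamily fC uC × 0ℚ <ℚ ε
      × countStable P τ fC uC ε compare countStable P τ fF uF ε

countStable-identity-fine : countStable {2} (deterministic id) 1 id δ ½ ≡ 2
countStable-identity-fine = refl

countStable-identity-coarse : countStable {2} (deterministic id) 1 collapse (λ _ → δ zero) ½ ≡ 1
countStable-identity-coarse = refl

countStable-swap-fine : countStable (deterministic swap) 1 id δ ½ ≡ 0
countStable-swap-fine = refl

countStable-swap-coarse : countStable (deterministic swap) 1 collapse (λ _ → δ zero) ½ ≡ 1
countStable-swap-coarse = refl

finer-has-more-stable : CoarseFineExample _<_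
finer-has-more-stable =
  2 , deterministic id , 1 , 2 , 1 , id , collapse , collapse , δ , (λ _ → δ zero) , ½ ,
  deterministic-isStochastic id , ≤-refl , (λ _ → refl) ,
  δ-isPrototypeFamily , collapse-isPrototypeFamily (δ-isDist zero) , ℚ.positive⁻¹ ½ ,
  subst₂ _<_ (sym countStable-identity-coarse) (sym countStable-identity-fine) (n<1+n 1)

finer-has-fewer-stable : CoarseFineExample _>_
finer-has-fewer-stable =
  2 , deterministic swap , 1 , 2 , 1 , id , collapse , collapse , δ , (λ _ → δ zero) , ½ ,
  deterministic-isStochastic swap , ≤-refl , (λ _ → refl) ,
  δ-isPrototypeFamily , collapse-isPrototypeFamily (δ-isDist zero) , ℚ.positive⁻¹ ½ ,
  subst₂ _>_ (sym countStable-swap-coarse) (sym countStable-swap-fine) (n<1+n 0)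

mainTheorem2 :
    (∃[ n ] Σ (Kernel n) λ P → Σ ℕ λ τ → ∃[ mF ] ∃[ mC ]
       Σ (Fin n → Fin mF) λ fF → Σ (Fin n → Fin mC) λ fC → Σ (Fin mF → Fin mC) λ g →
       Σ (Fin mF → Vec n) λ uF → Σ (Fin mC → Vec n) λ uC → Σ ℚ λ ε →
         IsStochastic P × τ ≥ 1 × (∀ z → fC z ≡ g (fF z))
         × IsPrototypeFamily fF uF × IsPrototypeFamily fC uC × 0ℚ <ℚ ε
         × countStable P τ fC uC ε < countStable P τ fF uF ε)
    ×
    (∃[ n ] Σ (Kernel n) λ P → Σ ℕ λ τ → ∃[ mF ] ∃[ mC ]
       Σ (Fin n → Fin mF) λ fF → Σ (Fin n → Fin mC) λ fC → Σ (Fin mF → Fin mC) λ g →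
       Σ (Fin mF → Vec n) λ uF → Σ (Fin mC → Vec n) λ uC → Σ ℚ λ ε →
         IsStochastic P × τ ≥ 1 × (∀ z → fC z ≡ g (fF z))
         × IsPrototypeFamily fF uF × IsPrototypeFamily fC uC × 0ℚ <ℚ ε
         × countStable P τ fF uF ε < countStable P τ fC uC ε)
mainTheorem2 = finer-has-more-stable , finer-has-fewer-stable
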